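{- For every statement $S$ of the language Rec (interpreted relative to a fixed well-formed procedure table $T$), the denotational finite-trace semantics coincides with the finite-trace semantics induced by the structural operational semantics: $\mathcal{S}_{tr}[\![S]\!] = \mathcal{S}_{sos}[\![S]\!]$.
   Context: Rec programs: a Rec program is a pair $\langle S,T\rangle$ where $S$ is a statement generated by $S ::= \mathbf{skip} \mid x := a \mid S_1;S_2 \mid \mathbf{if}\ b\ \mathbf{then}\ S_1\ \mathbf{else}\ S_2 \mid m()$, and $T$ (the procedure table) is a finite list of declarations $m\,\{S_m\}$ of parameterless procedures; procedure names are unique and only declared procedures are called. Here $a$ ranges over side-effect-free arithmetic expressions and $b$ over side-effect-free Boolean expressions; all variables are global and range over $\mathbb{Z}$. $\mathbf{State}$ is the set of maps $s:\mathit{Var}\to\mathbb{Z}$; $\mathcal{A}[\![a]\!](s)\in\mathbb{Z}$ and $\mathcal{B}[\![b]\!](s)\in\{\mathbf{tt},\mathbf{ff}\}$ denote evaluation in $s$; $s[x\mapsto v]$ is state update. $\mathbf{State}^+$ is the set of nonempty finite sequences of states $s_0\cdot s_1\cdots s_n$. SOS: configurations are pairs $\langle S,s\rangle$ or final states $s$. Transitions: $\langle\mathbf{skip},s\rangle\Rightarrow s$; $\langle x:=a,s\rangle\Rightarrow s[x\mapsto\mathcal{A}[\![a]\!](s)]$; if $\langle S_1,s\rangle\Rightarrow s'$ then $\langle S_1;S_2,s\rangle\Rightarrow\langle S_2,s'\rangle$; if $\langle S_1,s\rangle\Rightarrow\langle S_1',s'\rangle$ then $\langle S_1;S_2,s\rangle\Rightarrow\langle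 S_1';S_2,s'\rangle$; $\langle \mathbf{if}\ b\ \mathbf{then}\ S_1\ \mathbf{else}\ S_2,s\rangle\Rightarrow\langle S_1,s\rangle$ if $\mathcal{B}[\![b]\!](s)=\mathbf{tt}$, and $\Rightarrow\langle S_2,s\rangle$ if $\mathcal{B}[\![b]\!](s)=\mathbf{ff}$; $\langle m(),s\rangle\Rightarrow\langle S_m,s\rangle$ if $m\,\{S_m\}$ is in $T$. The induced semantics $\mathcal{S}_{sos}[\![S]\!]$ is the set of sequences $s_0\cdots s_n$ ($n\ge 1$) for which there are statements $S_0=S,S_1,\dots,S_{n-1}$ with $\langle S_i,s_i\rangle\Rightarrow\langle S_{i+1},s_{i+1}\rangle$ for $0\le i\le n-2$ and $\langle S_{n-1},s_{n-1}\rangle\Rightarrow s_n$. Denotational semantics: for $A,B\subseteq\mathbf{State}^+$ let $A|_b=\{s\cdot\sigma\in A:\mathcal{B}[\![b]\!](s)=\mathbf{tt}\}$, $\sharp A=\{s\cdot s\cdot\sigma: s\cdot\sigma\in A\}$, and $A\frown B=\{\sigma_A\cdot s\cdot\sigma_B:\sigma_A\cdot s\in A,\ s\cdot\sigma_B\in B\}$ ($\sigma_A,\sigma_B$ possibly empty). Let $M=\{m_1,\dots,m_n\}$ be the procedures declared in $T$ as $m_i\,\{S_i\}$. For $\rho:M\to 2^{\mathbf{State}^+}$ define $\mathcal{S}_{tr}[\![\mathbf{skip}]\!]_\rho=\{s\cdot s\}$, $\mathcal{S}_{tr}[\![x:=a]\!]_\rho=\{s\cdot s[x\mapsto\mathcal{A}[\![a]\!](s)]\}$,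 $\mathcal{S}_{tr}[\![S_1;S_2]\!]_\rho=\mathcal{S}_{tr}[\![S_1]\!]_\rho\frown\mathcal{S}_{tr}[\![S_2]\!]_\rho$, $\mathcal{S}_{tr}[\![\mathbf{if}\ b\ \mathbf{then}\ S_1\ \mathbf{else}\ S_2]\!]_\rho=(\sharp\mathcal{S}_{tr}[\![S_1]\!]_\rho)|_b\cup(\sharp\mathcal{S}_{tr}[\![S_2]\!]_\rho)|_{\neg b}$, $\mathcal{S}_{tr}[\![m_i()]\!]_\rho=\rho(m_i)$ (all with $s$ ranging over $\mathbf{State}$). Let $H(\rho)=(\sharp\mathcal{S}_{tr}[\![S_1]\!]_\rho,\dots,\sharp\mathcal{S}_{tr}[\![S_n]\!]_\rho)$, let $\rho_0$ be its least fixed point w.r.t. pointwise inclusion, and $\mathcal{S}_{tr}[\![S]\!]=\mathcal{S}_{tr}[\![S]\!]_{\rho_0}$. -}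

module Defs where

open import Level using (Level; Lift; lift; _⊔_) renaming (zero to 0ℓ; suc to lsuc)
open import Data.Nat using (ℕ)
open import Data.Fin using (Fin)
open import Data.Integer using (ℤ)
open import Data.Bool using (Bool; true; false; if_then_else_)
open import Data.List using (List; []; _∷_)
open import Data.List.NonEmpty using (List⁺; _∷_; head; _++⁺_; _∷ʳ_)
open import Data.Product using (Σ; _×_; ∃; _,_)
open import Relation.Nullary using (does)
open import Relation.Binary.Definitions using (DecidableEquality)
open import Relation.Binary.PropositionalEquality using (_≡_)
open import Relation.Unary using (Pred; _⊆_)

-- The (side-effect-free) expression language is left abstract: any set of
-- variables with decidable equality, any arithmetic / Boolean expressions
-- with an evaluation function.
record Lang : Set₁ where
  field
    Var  : Set
    _≟v_ : DecidableEquality Var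
    AExp : Set
    BExp : Set
    𝒜    : AExp → (Var → ℤ) → ℤ
    ℬ    : BExp → (Var → ℤ) → Bool

module _ (L : Lang) where
  open Lang L

  State : Set
  State = Var → ℤ

  upd : State → Var → ℤ → State
  upd s x v y = if does (y ≟v x) then v else s y

  -- Statements over a procedure table with n procedures, named by Fin n
  -- (names unique, only declared procedures can be called).
  data Stmt (n : ℕ) : Set where
    skip   : Stmt n
    _:=_   : Var → AExp → Stmt n
    _⨾_    : Stmt n → Stmt n → Stmt n
    If_Then_Else_ : BExp → Stmt n → Stmt n → Stmt n
    call   : Fin n → Stmt n

  Table : ℕ → Set
  Table n = Fin n → Stmt n

  State⁺ : Set
  State⁺ = List⁺ State

  data Config (n : ℕ) : Set where
    ⟨_,_⟩ : Stmt n → State → Config n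
    fin   : State → Config n

  data Step {n : ℕ} (T : Table n) : Stmt n → State → Config n → Set where
    skip-step : ∀ {s} → Step T skip s (fin s)
    ass-step  : ∀ {x a s} → Step T (x := a) s (fin (upd s x (𝒜 a s)))
    seq-fin   : ∀ {S₁ S₂ s s'} → Step T S₁ s (fin s') →
                Step T (S₁ ⨾ S₂) s ⟨ S₂ , s' ⟩
    seq-step  : ∀ {S₁ S₁' S₂ s s'} → Step T S₁ s ⟨ S₁' , s' ⟩ →
                Step T (S₁ ⨾ S₂) s ⟨ S₁' ⨾ S₂ , s' ⟩
    if-tt     : ∀ {b S₁ S₂ s} → ℬ b s ≡ true →
                Step T (If b Then S₁ Else S₂) s ⟨ S₁ , s ⟩
    if-ff     : ∀ {b S₁ S₂ s} → ℬ b s ≡ false →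
                Step T (If b Then S₁ Else S₂) s ⟨ S₂ , s ⟩
    call-step : ∀ {i s} → Step T (call i) s ⟨ T i , s ⟩

  -- Run T S (s₀ ∷ s₁ ⋯ sₙ): there are S₀ = S, S₁, …, Sₙ₋₁ with
  -- ⟨Sᵢ,sᵢ⟩ ⇒ ⟨Sᵢ₊₁,sᵢ₊₁⟩ for i ≤ n-2 and ⟨Sₙ₋₁,sₙ₋₁⟩ ⇒ sₙ  (n ≥ 1).
  data Run {n : ℕ} (T : Table n) : Stmt n → State⁺ → Set where
    run-fin  : ∀ {S s s'} → Step T S s (fin s') → Run T S (s ∷ s' ∷ [])
    run-step : ∀ {S S' s s' σ} → Step T S s ⟨ S' , s' ⟩ →
               Run T S' (s' ∷ σ) → Run T S (s ∷ s' ∷ σ)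

  𝒮sos : ∀ {n} → Table n → Stmt n → Pred State⁺ 0ℓ
  𝒮sos T S = Run T S

  restrict : ∀ {ℓ} → Pred State⁺ ℓ → BExp → Bool → Pred State⁺ ℓ
  restrict {ℓ} A b v σ = A σ × Lift ℓ (ℬ b (head σ) ≡ v)

  ♯ : ∀ {ℓ} → Pred State⁺ ℓ → Pred State⁺ ℓ
  ♯ {ℓ} A σ = Σ State λ s → Σ (List State) λ σ' →
            A (s ∷ σ') × Lift ℓ (σ ≡ (s ∷ (s ∷ σ')))

  _⌢_ : ∀ {ℓ} → Pred State⁺ ℓ → Pred State⁺ ℓ → Pred State⁺ ℓ
  _⌢_ {ℓ} A B σ = Σ (List State) λ σA → Σ State λ s → Σ (List State) λ σB →
                A (σA ∷ʳ s) × B (s ∷ σB) × Lift ℓ (σ ≡ (σA ++⁺ (s ∷ σB)))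

  𝒮tr⟦_⟧ : ∀ {ℓ n} → Stmt n → (Fin n → Pred State⁺ ℓ) → Pred State⁺ ℓ
  𝒮tr⟦_⟧ {ℓ} skip ρ σ = Σ State λ s → Lift ℓ (σ ≡ (s ∷ s ∷ []))
  𝒮tr⟦_⟧ {ℓ} (x := a) ρ σ = Σ State λ s → Lift ℓ (σ ≡ (s ∷ upd s x (𝒜 a s) ∷ []))
  𝒮tr⟦ S₁ ⨾ S₂ ⟧ ρ = 𝒮tr⟦ S₁ ⟧ ρ ⌢ 𝒮tr⟦ S₂ ⟧ ρ
  𝒮tr⟦ If b Then S₁ Else S₂ ⟧ ρ σ =
    restrict (♯ (𝒮tr⟦ S₁ ⟧ ρ)) b true σ ⊎' restrict (♯ (𝒮tr⟦ S₂ ⟧ ρ)) b false σ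
    where open import Data.Sum using () renaming (_⊎_ to _⊎'_)
  𝒮tr⟦ call i ⟧ ρ = ρ i

  H : ∀ {ℓ n} → Table n → (Fin n → Pred State⁺ ℓ) → (Fin n → Pred State⁺ ℓ)
  H T ρ i = ♯ (𝒮tr⟦ T i ⟧ ρ)

  PreFixed : ∀ {ℓ n} → Table n → (Fin n → Pred State⁺ ℓ) → Set ℓ
  PreFixed T ρ = ∀ i → H T ρ i ⊆ ρ i

  -- Least fixed point of the monotone H (Knaster–Tarski):
  -- intersection of all pre-fixed points.
  ρ₀ : ∀ {n} → Table n → Fin n → Pred State⁺ (lsuc 0ℓ)
  ρ₀ T i σ = (ρ : _ → Pred State⁺ 0ℓ) → PreFixed T ρ → ρ i σ

  𝒮tr : ∀ {n} → Table n → Stmt n → Pred State⁺ (lsuc 0ℓ)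
  𝒮tr T S = 𝒮tr⟦ S ⟧ (ρ₀ T)

{-# OPTIONS --safe #-}
-- The family of SOS runs of the calls
-- m() is itself a pre-fixed point, and every denotational trace over it is an
-- SOS run; minimality and monotonicity of 𝒮tr⟦S⟧ in ρ give 𝒮tr ⊆ 𝒮sos.
-- Conversely, in any pre-fixed point a transition ⟨S,s⟩ ⇒ ⟨S',s'⟩ turns a
-- trace s'·τ of S' into the trace s·s'·τ of S, so every run is a trace by
-- induction on the run; ρ₀ is itself pre-fixed, which gives 𝒮sos ⊆ 𝒮tr.
module Submission where

open import Defs
open import Data.Nat using (ℕ)
open import Data.Fin using (Fin)
open import Data.List using ([]; _∷_)
open import Data.List.NonEmpty using (_∷_; _∷ʳ_; _++⁺_)
open import Data.Product using (_,_)
open import Data.Sum using (inj₁; inj₂)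
open import Level using (Level; lift) renaming (zero to 0ℓ; suc to lsuc)
open import Relation.Binary.PropositionalEquality using (_≡_; refl)
open import Relation.Unary using (Pred; _⊆_; _≐_)

module _ (L : Lang) {n : ℕ} (T : Table L n) where

  Env : (ℓ : Level) → Set (lsuc ℓ)
  Env ℓ = Fin n → Pred (State⁺ L) ℓ

  𝒮tr-mono : ∀ {ℓ ℓ'} (S : Stmt L n) {ρ : Env ℓ} {ρ' : Env ℓ'} →
             (∀ i → ρ i ⊆ ρ' i) → 𝒮tr⟦_⟧ L S ρ ⊆ 𝒮tr⟦_⟧ L S ρ'
  𝒮tr-mono skip                    ρ⊆ρ' (s , lift eq) = s , lift eq
  𝒮tr-mono (x := a)                ρ⊆ρ' (s , lift eq) = s , lift eq
  𝒮tr-mono (S₁ ⨾ S₂)               ρ⊆ρ' (σA , s , σB , p , q , lift eq) =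
    σA , s , σB , 𝒮tr-mono S₁ ρ⊆ρ' p , 𝒮tr-mono S₂ ρ⊆ρ' q , lift eq
  𝒮tr-mono (If b Then S₁ Else S₂) ρ⊆ρ' (inj₁ ((s , σ , p , lift eq) , lift b≡tt)) =
    inj₁ ((s , σ , 𝒮tr-mono S₁ ρ⊆ρ' p , lift eq) , lift b≡tt)
  𝒮tr-mono (If b Then S₁ Else S₂) ρ⊆ρ' (inj₂ ((s , σ , p , lift eq) , lift b≡ff)) =
    inj₂ ((s , σ , 𝒮tr-mono S₂ ρ⊆ρ' p , lift eq) , lift b≡ff)
  𝒮tr-mono (call i)                ρ⊆ρ' p = ρ⊆ρ' i p

  ρ₀-least : {ρ : Env 0ℓ} → PreFixed L T ρ → ∀ i → ρ₀ L T i ⊆ ρ i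
  ρ₀-least {ρ} ρ-pre i p = p ρ ρ-pre

  ρ₀-preFixed : PreFixed L T (ρ₀ L T)
  ρ₀-preFixed i (s , σ , p , lift eq) ρ ρ-pre =
    ρ-pre i (s , σ , 𝒮tr-mono (T i) (ρ₀-least ρ-pre) p , lift eq)

  module _ {ℓ} {ρ : Env ℓ} (ρ-pre : PreFixed L T ρ) where

    final-step⇒𝒮tr : ∀ {S s s'} → Step L T S s (fin s') → 𝒮tr⟦_⟧ L S ρ (s ∷ s' ∷ [])
    final-step⇒𝒮tr (skip-step {s}) = s , lift refl
    final-step⇒𝒮tr (ass-step {s = s}) = s , lift refl

    step-extends-𝒮tr : ∀ {S S' s s' τ} → Step L T S s ⟨ S' , s' ⟩ →
                       𝒮tr⟦_⟧ L S' ρ (s' ∷ τ) → 𝒮tr⟦_⟧ L S ρ (s ∷ s' ∷ τ)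
    step-extends-𝒮tr {s = s} {s'} {τ} (seq-fin st) p =
      s ∷ [] , s' , τ , final-step⇒𝒮tr st , p , lift refl
    step-extends-𝒮tr {s = s} (seq-step st) ([] , m , σB , p , q , lift refl) =
      s ∷ [] , m , σB , step-extends-𝒮tr st p , q , lift refl
    step-extends-𝒮tr {s = s} (seq-step st) (a ∷ σA , m , σB , p , q , lift refl) =
      s ∷ a ∷ σA , m , σB , step-extends-𝒮tr st p , q , lift refl
    step-extends-𝒮tr {s = s} {τ = τ} (if-tt b≡tt) p = inj₁ ((s , τ , p , lift refl) , lift b≡tt)
    step-extends-𝒮tr {s = s} {τ = τ} (if-ff b≡ff) p = inj₂ ((s , τ , p , lift refl) , lift b≡ff)
    step-extends-𝒮tr {s = s} {τ = τ} (call-step {i}) p = ρ-pre i (s , τ , p , lift refl)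

    run⇒𝒮tr : ∀ {S} → Run L T S ⊆ 𝒮tr⟦_⟧ L S ρ
    run⇒𝒮tr (run-fin st)    = final-step⇒𝒮tr st
    run⇒𝒮tr (run-step st r) = step-extends-𝒮tr st (run⇒𝒮tr r)

  callRuns : Env 0ℓ
  callRuns i = Run L T (call i)

  run-⨾ : ∀ {S₁ S₂ τ} → Run L T S₁ τ → ∀ σA {m σB} → τ ≡ σA ∷ʳ m →
          Run L T S₂ (m ∷ σB) → Run L T (S₁ ⨾ S₂) (σA ++⁺ (m ∷ σB))
  run-⨾ (run-fin st)    (_ ∷ [])         refl r₂ = run-step (seq-fin st) r₂
  run-⨾ (run-step st r) (_ ∷ s' ∷ σA)    refl r₂ = run-step (seq-step st) (run-⨾ r (s' ∷ σA) refl r₂)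
  run-⨾ (run-step st ()) (_ ∷ [])        refl r₂
  run-⨾ (run-fin st)    []               ()   r₂
  run-⨾ (run-fin st)    (_ ∷ _ ∷ [])     ()   r₂
  run-⨾ (run-fin st)    (_ ∷ _ ∷ _ ∷ _)  ()   r₂
  run-⨾ (run-step st r) []               ()   r₂

  𝒮tr-callRuns⇒run : ∀ S → 𝒮tr⟦_⟧ L S callRuns ⊆ Run L T S
  𝒮tr-callRuns⇒run skip     (s , lift refl) = run-fin skip-step
  𝒮tr-callRuns⇒run (x := a) (s , lift refl) = run-fin ass-step
  𝒮tr-callRuns⇒run (S₁ ⨾ S₂) (σA , m , σB , p , q , lift refl) =
    run-⨾ (𝒮tr-callRuns⇒run S₁ p) σA refl (𝒮tr-callRuns⇒run S₂ q)
  𝒮tr-callRuns⇒run (If b Then S₁ Else S₂) (inj₁ ((s , τ , p , lift refl) , lift b≡tt)) =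
    run-step (if-tt b≡tt) (𝒮tr-callRuns⇒run S₁ p)
  𝒮tr-callRuns⇒run (If b Then S₁ Else S₂) (inj₂ ((s , τ , p , lift refl) , lift b≡ff)) =
    run-step (if-ff b≡ff) (𝒮tr-callRuns⇒run S₂ p)
  𝒮tr-callRuns⇒run (call i) p = p

  callRuns-preFixed : PreFixed L T callRuns
  callRuns-preFixed i (s , τ , p , lift refl) = run-step call-step (𝒮tr-callRuns⇒run (T i) p)

mainTheorem1 : (L : Lang) (n : ℕ) (T : Table L n) (S : Stmt L n) →
    𝒮tr L T S ≐ 𝒮sos L T S
mainTheorem1 L n T S = 𝒮tr⊆𝒮sos , 𝒮sos⊆𝒮tr
  where
  𝒮tr⊆𝒮sos : 𝒮tr L T S ⊆ 𝒮sos L T S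
  𝒮tr⊆𝒮sos p = 𝒮tr-callRuns⇒run L T S
                 (𝒮tr-mono L T S (ρ₀-least L T (callRuns-preFixed L T)) p)

  𝒮sos⊆𝒮tr : 𝒮sos L T S ⊆ 𝒮tr L T S
  𝒮sos⊆𝒮tr = run⇒𝒮tr L T (ρ₀-preFixed L T)
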